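{- Let $\alpha$ be a weak composition of length $n$. Then \[\tilde{\mathcal{A}}_\alpha(x_1,\ldots,x_n)=\sum_{\alpha\trianglelefteq\beta\trianglelefteq\operatorname{qshift}(\alpha)}x^\beta,\] where the sum is over weak compositions $\beta$ of length $n$.
   Context: A weak composition of length $n$ is $\alpha=(\alpha_1,\ldots,\alpha_n)\in\mathbb{Z}_{\ge0}^n$; $x^\alpha=x_1^{\alpha_1}\cdots x_n^{\alpha_n}$. The flat $\operatorname{flat}(\alpha)$ is obtained by moving all zero entries of $\alpha$ to the right end (keeping the order of the nonzero entries). $S_n$ acts on length-$n$ vectors with $s_i$ exchanging the entries in positions $i$ and $i+1$; $w_\alpha\in S_n$ is a permutation of minimal length with $w_\alpha(\alpha)=\operatorname{flat}(\alpha)$. Dominance order: $\beta\trianglelefteq\gamma$ iff $\beta_1+\cdots+\beta_j\le\gamma_1+\cdots+\gamma_j$ for all $j$. Quasisymmetric action: $\tilde{s}_i(\beta)$ exchanges the entries in positions $i,i+1$ if $\beta_i=0$ or $\beta_{i+1}=0$, and fixes $\beta$ otherwise. For $1\le i\le n-1$ define linear operators on $\mathbb{C}[x_1,\ldots,x_n]$ by $\tilde{\pi}_i(x^\beta)=\dfrac{x_ix^\beta-x_{i+1}x^{\tilde{s}_i(\beta)}}{x_i-x_{i+1}}$ and $\tilde{\theta}_i=\tilde{\pi}_i-1$. For $w\in S_n$ with reduced word $w=s_{i_1}\cdots s_{i_k}$ set $\tilde{\theta}_w=\tilde{\theta}_{i_1}\cdots\tilde{\theta}_{i_k}$ (independent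 of the reduced word, since the $\tilde\theta_i$ satisfy the braid relations). The fundamental Demazure atom is $\tilde{\mathcal{A}}_\alpha=\tilde{\theta}_{w_\alpha^{ -1}}x^{\operatorname{flat}(\alpha)}$. Fundamental shift: for $v=(v_1,\ldots,v_n)$ with nonnegative integer entries, let $S=\{i_1<\cdots<i_k\}$ be the positions of nonzero entries. Then $\operatorname{qshift}(v)=(w_1,\ldots,w_n)$ where: (1) for $j\in S$, $w_j=v_j$ if $j=1$ or $j-1\in S$, and $w_j=1$ otherwise; (2) if $i_j\in S$, $j<k$, $i_j+1\notin S$, then $w_{i_j+1}=v_{i_{j+1}}-1$; (3) if $1\notin S$ (and $S\ne\emptyset$), $w_1=v_{i_1}-1$; (4) all other $w_j=0$. Example: $\operatorname{qshift}(0,0,3,0,1,4,0,5)=(2,0,1,0,1,4,4,1)$. -}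

module Defs where

open import Data.Nat using (ℕ; zero; suc; _+_; _∸_; _≤_; _<_; _≟_; _<ᵇ_)
open import Data.Integer as ℤ using (ℤ; +_; -_)
open import Data.List using (List; []; _∷_; _++_; [_]; map; concatMap; foldl; foldr; length; upTo)
open import Data.Vec as Vec using (Vec; []; _∷_; _∷ʳ_)
open import Data.Vec.Properties using (≡-dec)
open import Data.Product using (_×_; _,_)
open import Data.Bool using (Bool; true; false; if_then_else_)
open import Relation.Binary.PropositionalEquality using (_≡_)
open import Relation.Nullary using (yes; no)

-- Weak compositions of length n and exponent vectors of monomials.
WComp : ℕ → Set
WComp n = Vec ℕ n

-- Polynomials in ℤ[x₁,…,xₙ] (⊆ ℂ[x₁,…,xₙ]) as formal finite sums  Σ c·x^γ .
Poly : ℕ → Set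
Poly n = List (ℤ × WComp n)

mono : ∀ {n} → WComp n → Poly n
mono γ = [ (+ 1 , γ) ]

coeff : ∀ {n} → Poly n → WComp n → ℤ
coeff [] γ = + 0
coeff ((c , δ) ∷ p) γ with ≡-dec _≟_ δ γ
... | yes _ = c ℤ.+ coeff p γ
... | no  _ = coeff p γ

linear : ∀ {n} → (WComp n → Poly n) → Poly n → Poly n
linear f = concatMap (λ { (c , β) → map (λ { (d , γ) → (c ℤ.* d , γ) }) (f β) })

flat : ∀ {n} → WComp n → WComp n
flat [] = []
flat (zero ∷ v) = flat v ∷ʳ zero
flat (suc a ∷ v) = suc a ∷ flat v

-- s_i (1 ≤ i ≤ n-1, 1-based) exchanging entries in positions i and i+1;
-- acts as the identity for out-of-range indices
swapAt : ∀ {n} → ℕ → WComp n → WComp n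
swapAt (suc zero) (a ∷ b ∷ v) = b ∷ a ∷ v
swapAt (suc (suc i)) (a ∷ v) = a ∷ swapAt (suc i) v
swapAt _ v = v

act : ∀ {n} → List ℕ → WComp n → WComp n
act u v = foldr swapAt v u

-- u is a word of minimal length among all words w with w(α) = flat(α);
-- equivalently u is a reduced word for w_α.
IsMinFlatWord : ∀ {n} → WComp n → List ℕ → Set
IsMinFlatWord α u =
  (act u α ≡ flat α) × (∀ u′ → act u′ α ≡ flat α → length u ≤ length u′)

liftAt : ∀ {n} → ℕ → (ℕ → ℕ → List (ℤ × ℕ × ℕ)) → WComp n → Poly n
liftAt (suc zero) f (a ∷ b ∷ v) = map (λ { (c , a′ , b′) → (c , a′ ∷ b′ ∷ v) }) (f a b)
liftAt (suc (suc i)) f (a ∷ v) = map (λ { (c , w) → (c , a ∷ w) }) (liftAt (suc i) f v)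
liftAt _ f v = mono v

-- divided difference ∂(x^a y^b) = (x^a y^b − x^b y^a)/(x − y) in closed form
ddPair : ℕ → ℕ → List (ℤ × ℕ × ℕ)
ddPair a b with b <ᵇ a | a <ᵇ b
... | true  | _     = map (λ k → (+ 1 , a ∸ 1 ∸ k , b + k)) (upTo (a ∸ b))
... | false | true  = map (λ k → (- (+ 1) , a + k , b ∸ 1 ∸ k)) (upTo (b ∸ a))
... | false | false = []

-- quasisymmetric π̃_i on x_i^a x_{i+1}^b:
--  if a,b ≠ 0 then s̃_i fixes β and the quotient is x^β;
--  otherwise s̃_i = s_i on β and π̃_i(x^β) = ∂_i(x_i x^β).
piPair : ℕ → ℕ → List (ℤ × ℕ × ℕ)
piPair (suc a) (suc b) = [ (+ 1 , suc a , suc b) ]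
piPair a b = ddPair (suc a) b

thetaPair : ℕ → ℕ → List (ℤ × ℕ × ℕ)
thetaPair a b = piPair a b ++ [ (- (+ 1) , a , b) ]

θ̃ : ∀ {n} → ℕ → Poly n → Poly n
θ̃ i = linear (liftAt i thetaPair)

-- For a reduced word u = (j₁,…,j_k) of w_α (w_α = s_{j₁}⋯s_{j_k}), the word
-- (j_k,…,j₁) is reduced for w_α⁻¹, so θ̃_{w_α⁻¹} = θ̃_{j_k} ⋯ θ̃_{j₁}.
atom : ∀ {n} → WComp n → List ℕ → Poly n
atom α u = foldl (λ p j → θ̃ j p) (mono (flat α)) u

data Prev : Set where
  start nz z : Prev

firstNZ : ∀ {n} → Vec ℕ n → ℕ
firstNZ [] = 0
firstNZ (zero ∷ v) = firstNZ v
firstNZ (suc a ∷ v) = suc a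

qgo : ∀ {n} → Prev → Vec ℕ n → Vec ℕ n
qgo p [] = []
qgo z (suc a ∷ v) = 1 ∷ qgo nz v
qgo start (suc a ∷ v) = suc a ∷ qgo nz v
qgo nz (suc a ∷ v) = suc a ∷ qgo nz v
qgo z (zero ∷ v) = 0 ∷ qgo z v
qgo start (zero ∷ v) = (firstNZ v ∸ 1) ∷ qgo z v
qgo nz (zero ∷ v) = (firstNZ v ∸ 1) ∷ qgo z v

qshift : ∀ {n} → WComp n → WComp n
qshift = qgo start

psum : ∀ {n} → ℕ → Vec ℕ n → ℕ
psum zero _ = 0
psum (suc j) [] = 0
psum (suc j) (a ∷ v) = a + psum j v

_⊴_ : ∀ {n} → WComp n → WComp n → Set
β ⊴ γ = ∀ j → psum j β ≤ psum j γ

{-# OPTIONS --safe #-}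
-- A swap of adjacent entries removes at most one pair "zero entry before a nonzero entry",
-- and a swap removing one exists while such pairs remain; so a minimal word flattening α
-- has exactly that many letters, and along it every letter j swaps an ascent (0, a+1) at
-- positions j, j+1. The atom is therefore obtained from x^(flat α), which is the interval
-- sum of the flat composition since qshift fixes it, by steps of the form: if p is the sum
-- of x^β over [s_j α, qshift (s_j α)], then θ̃_j p is the sum of x^β over [α, qshift α].
--
-- For the step: θ̃_j sends x_j^g (resp. x_(j+1)^g) to the sum (resp. minus the sum) of the
-- monomials x_j^e x_(j+1)^f with e + f = g and f > 0, and kills every other monomial in
-- these two variables. Hence the coefficient of x^β in θ̃_j p vanishes if β_(j+1) = 0 and
-- is otherwise that of x^β′ minus that of x^β″ in p, where β′ and β″ gather β_j + β_(j+1)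
-- in position j and j+1 respectively. The i-th partial sum of qshift α exceeds that of α by
-- the next nonzero entry minus one when α_i = 0, and by 0 otherwise; comparing partial sums
-- shows that β′ lies in the interval of s_j α exactly when β lies in that of α, and that β″
-- never lies in the interval of s_j α.
module Submission where

open import Defs
open import Data.Nat using (ℕ; zero; suc; _+_; _∸_; _≤_; _<_; z≤n; s≤s; z<s; s<s)
open import Data.Nat.Properties
open import Data.Integer as ℤ using (ℤ; 0ℤ; 1ℤ; -1ℤ; -_)
  renaming (_+_ to _+ℤ_; _*_ to _*ℤ_; _-_ to _-ℤ_)
import Data.Integer.Properties as ℤ
open import Data.Integer.Solver using (module +-*-Solver)
open import Data.List using (List; []; _∷_; _++_; [_]; length; _∷ʳ_; map; applyUpTo; foldl)
open import Data.List.Properties using (foldr-++; length-++; map-upTo)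
open import Data.Vec as Vec using (Vec; []; _∷_)
open import Data.Vec.Properties as Vec using (∷-injectiveˡ; ∷-injectiveʳ)
open import Data.Product using (_×_; _,_; ∃-syntax; proj₁; proj₂; map₁; map₂)
open import Data.Product.Properties using () renaming (≡-dec to ×-≡-dec)
open import Data.Empty using (⊥-elim)
open import Function using (_∘′_)
open import Function.Definitions using (Injective)
open import Relation.Nullary using (¬_; Dec; yes; no)
open import Relation.Binary.Definitions using (DecidableEquality)
open import Relation.Binary.PropositionalEquality hiding ([_])

-- Inversions and minimal flattening words

nonzeros : ∀ {n} → Vec ℕ n → ℕ
nonzeros [] = 0
nonzeros (zero ∷ v) = nonzeros v
nonzeros (suc _ ∷ v) = suc (nonzeros v)

inversions : ∀ {n} → Vec ℕ n → ℕ
inversions [] = 0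
inversions (zero ∷ v) = nonzeros v + inversions v
inversions (suc _ ∷ v) = inversions v

data Ascent : ∀ {n} → ℕ → ℕ → Vec ℕ n → Set where
  here  : ∀ {n a} {v : Vec ℕ n} → Ascent 1 a (0 ∷ suc a ∷ v)
  there : ∀ {n j a x} {v : Vec ℕ n} → Ascent (suc j) a v → Ascent (suc (suc j)) a (x ∷ v)

ascent-∷ : ∀ {n j a x} {v : Vec ℕ n} → Ascent j a v → Ascent (suc j) a (x ∷ v)
ascent-∷ here = there here
ascent-∷ (there asc) = there (there asc)

nonzeros-swapAt : ∀ {n} j (v : Vec ℕ n) → nonzeros (swapAt j v) ≡ nonzeros v
nonzeros-swapAt zero v = refl
nonzeros-swapAt (suc zero) [] = refl
nonzeros-swapAt (suc zero) (x ∷ []) = refl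
nonzeros-swapAt (suc zero) (zero ∷ zero ∷ v) = refl
nonzeros-swapAt (suc zero) (zero ∷ suc y ∷ v) = refl
nonzeros-swapAt (suc zero) (suc x ∷ zero ∷ v) = refl
nonzeros-swapAt (suc zero) (suc x ∷ suc y ∷ v) = refl
nonzeros-swapAt (suc (suc i)) [] = refl
nonzeros-swapAt (suc (suc i)) (zero ∷ v) = nonzeros-swapAt (suc i) v
nonzeros-swapAt (suc (suc i)) (suc x ∷ v) = cong suc (nonzeros-swapAt (suc i) v)

inversions-swapAt-≤ : ∀ {n} j (v : Vec ℕ n) → inversions v ≤ suc (inversions (swapAt j v))
inversions-swapAt-≤ zero v = n≤1+n _
inversions-swapAt-≤ (suc zero) [] = n≤1+n _
inversions-swapAt-≤ (suc zero) (x ∷ []) = n≤1+n _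
inversions-swapAt-≤ (suc zero) (zero ∷ zero ∷ v) = n≤1+n _
inversions-swapAt-≤ (suc zero) (zero ∷ suc y ∷ v) = ≤-refl
inversions-swapAt-≤ (suc zero) (suc x ∷ zero ∷ v) = m≤n+m _ 2
inversions-swapAt-≤ (suc zero) (suc x ∷ suc y ∷ v) = n≤1+n _
inversions-swapAt-≤ (suc (suc i)) [] = n≤1+n _
inversions-swapAt-≤ (suc (suc i)) (zero ∷ v) rewrite nonzeros-swapAt (suc i) v =
  ≤-trans (+-monoʳ-≤ (nonzeros v) (inversions-swapAt-≤ (suc i) v)) (≤-reflexive (+-suc (nonzeros v) _))
inversions-swapAt-≤ (suc (suc i)) (suc x ∷ v) = inversions-swapAt-≤ (suc i) v

inversions-swapAt-<⇒ascent : ∀ {n} j (v : Vec ℕ n) →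
  inversions (swapAt j v) < inversions v → ∃[ a ] Ascent j a v
inversions-swapAt-<⇒ascent zero v lt = ⊥-elim (n≮n _ lt)
inversions-swapAt-<⇒ascent (suc zero) [] lt = ⊥-elim (n≮n _ lt)
inversions-swapAt-<⇒ascent (suc zero) (x ∷ []) lt = ⊥-elim (n≮n _ lt)
inversions-swapAt-<⇒ascent (suc zero) (zero ∷ zero ∷ v) lt = ⊥-elim (n≮n _ lt)
inversions-swapAt-<⇒ascent (suc zero) (zero ∷ suc y ∷ v) lt = y , here
inversions-swapAt-<⇒ascent (suc zero) (suc x ∷ zero ∷ v) lt = ⊥-elim (<⇒≱ lt (n≤1+n _))
inversions-swapAt-<⇒ascent (suc zero) (suc x ∷ suc y ∷ v) lt = ⊥-elim (n≮n _ lt)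
inversions-swapAt-<⇒ascent (suc (suc i)) [] lt = ⊥-elim (n≮n _ lt)
inversions-swapAt-<⇒ascent (suc (suc i)) (zero ∷ v) lt rewrite nonzeros-swapAt (suc i) v =
  let a , asc = inversions-swapAt-<⇒ascent (suc i) v (+-cancelˡ-< (nonzeros v) _ _ lt) in a , there asc
inversions-swapAt-<⇒ascent (suc (suc i)) (suc x ∷ v) lt =
  let a , asc = inversions-swapAt-<⇒ascent (suc i) v lt in a , there asc

inversions-swapAt-ascent : ∀ {n j a} {v : Vec ℕ n} → Ascent j a v →
  suc (inversions (swapAt j v)) ≡ inversions v
inversions-swapAt-ascent here = refl
inversions-swapAt-ascent {j = suc (suc j)} (there {x = zero} {v = v} asc)
  rewrite nonzeros-swapAt (suc j) v =
    trans (sym (+-suc (nonzeros v) _)) (cong (nonzeros v +_) (inversions-swapAt-ascent asc))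
inversions-swapAt-ascent (there {x = suc x} asc) = inversions-swapAt-ascent asc

flat-swapAt-ascent : ∀ {n j a} {v : Vec ℕ n} → Ascent j a v → flat (swapAt j v) ≡ flat v
flat-swapAt-ascent here = refl
flat-swapAt-ascent (there {x = zero} asc) = cong (Vec._∷ʳ 0) (flat-swapAt-ascent asc)
flat-swapAt-ascent (there {x = suc x} asc) = cong (suc x ∷_) (flat-swapAt-ascent asc)

nonzeros-∷ʳ0 : ∀ {n} (v : Vec ℕ n) → nonzeros (v Vec.∷ʳ 0) ≡ nonzeros v
nonzeros-∷ʳ0 [] = refl
nonzeros-∷ʳ0 (zero ∷ v) = nonzeros-∷ʳ0 v
nonzeros-∷ʳ0 (suc x ∷ v) = cong suc (nonzeros-∷ʳ0 v)

inversions-∷ʳ0 : ∀ {n} (v : Vec ℕ n) → inversions (v Vec.∷ʳ 0) ≡ inversions v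
inversions-∷ʳ0 [] = refl
inversions-∷ʳ0 (zero ∷ v) = cong₂ _+_ (nonzeros-∷ʳ0 v) (inversions-∷ʳ0 v)
inversions-∷ʳ0 (suc x ∷ v) = inversions-∷ʳ0 v

inversions-flat : ∀ {n} (v : Vec ℕ n) → inversions (flat v) ≡ 0
inversions-flat [] = refl
inversions-flat (zero ∷ v) = trans (inversions-∷ʳ0 (flat v)) (inversions-flat v)
inversions-flat (suc x ∷ v) = inversions-flat v

nonzeros≡0⇒∷ʳ0≡0∷ : ∀ {n} (v : Vec ℕ n) → nonzeros v ≡ 0 → v Vec.∷ʳ 0 ≡ 0 ∷ v
nonzeros≡0⇒∷ʳ0≡0∷ [] _ = refl
nonzeros≡0⇒∷ʳ0≡0∷ (zero ∷ v) h = cong (0 ∷_) (nonzeros≡0⇒∷ʳ0≡0∷ v h)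

inversions≡0⇒flat≡ : ∀ {n} (v : Vec ℕ n) → inversions v ≡ 0 → flat v ≡ v
inversions≡0⇒flat≡ [] _ = refl
inversions≡0⇒flat≡ (zero ∷ v) h
  rewrite inversions≡0⇒flat≡ v (m+n≡0⇒n≡0 (nonzeros v) h) =
    nonzeros≡0⇒∷ʳ0≡0∷ v (m+n≡0⇒m≡0 (nonzeros v) h)
inversions≡0⇒flat≡ (suc x ∷ v) h = cong (suc x ∷_) (inversions≡0⇒flat≡ v h)

inversions≢0⇒ascent : ∀ {n} (v : Vec ℕ n) → inversions v ≢ 0 → ∃[ j ] ∃[ a ] Ascent j a v
inversions≢0⇒ascent [] h = ⊥-elim (h refl)
inversions≢0⇒ascent (zero ∷ []) h = ⊥-elim (h refl)
inversions≢0⇒ascent (zero ∷ suc b ∷ v) h = 1 , b , here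
inversions≢0⇒ascent (zero ∷ zero ∷ v) h =
  let j , a , asc = inversions≢0⇒ascent (zero ∷ v) (h ∘′ drop-leading-zero) in suc j , a , ascent-∷ asc
  where
  drop-leading-zero : inversions (zero ∷ v) ≡ 0 → inversions (zero ∷ zero ∷ v) ≡ 0
  drop-leading-zero e = cong₂ _+_ (m+n≡0⇒m≡0 (nonzeros v) e) e
inversions≢0⇒ascent (suc x ∷ v) h =
  let j , a , asc = inversions≢0⇒ascent v h in suc j , a , ascent-∷ asc

act-∷ʳ : ∀ {n} (u : List ℕ) j (v : Vec ℕ n) → act (u ∷ʳ j) v ≡ act u (swapAt j v)
act-∷ʳ u j v = foldr-++ swapAt v u [ j ]

flattening-word : ∀ {n} (v : Vec ℕ n) →
  ∃[ u ] (act u v ≡ flat v) × (length u ≡ inversions v)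
flattening-word v = go (inversions v) v refl
  where
  go : ∀ {n} N (v : Vec ℕ n) → inversions v ≡ N → ∃[ u ] (act u v ≡ flat v) × (length u ≡ N)
  go zero v h = [] , sym (inversions≡0⇒flat≡ v h) , refl
  go (suc N) v h with inversions≢0⇒ascent v (λ e → 0≢1+n (trans (sym e) h))
  ... | j , a , asc with go N (swapAt j v) (suc-injective (trans (inversions-swapAt-ascent asc) h))
  ... | u , e , l =
    u ∷ʳ j , trans (act-∷ʳ u j v) (trans e (flat-swapAt-ascent asc)) ,
    trans (length-++ u) (trans (+-comm (length u) 1) (cong suc l))

inversions≤length+inversions-act : ∀ {n} (u : List ℕ) (v : Vec ℕ n) →
  inversions v ≤ length u + inversions (act u v)
inversions≤length+inversions-act [] v = ≤-refl
inversions≤length+inversions-act (j ∷ u) v = begin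
  inversions v                                       ≤⟨ inversions≤length+inversions-act u v ⟩
  length u + inversions (act u v)                    ≤⟨ +-monoʳ-≤ (length u) (inversions-swapAt-≤ j (act u v)) ⟩
  length u + suc (inversions (act (j ∷ u) v))        ≡⟨ +-suc (length u) _ ⟩
  suc (length u) + inversions (act (j ∷ u) v)        ∎
  where open ≤-Reasoning

-- Partial sums of qshift

excess : ∀ {n} → ℕ → Vec ℕ n → ℕ
excess zero _ = 0
excess (suc _) [] = 0
excess (suc zero) (zero ∷ v) = firstNZ v ∸ 1
excess (suc zero) (suc _ ∷ _) = 0
excess (suc (suc i)) (_ ∷ v) = excess (suc i) v

psum-qgo-z : ∀ {n} i (v : Vec ℕ n) →
  psum (suc i) (qgo z v) + (firstNZ v ∸ 1) ≡ psum (suc i) (qgo nz v)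
psum-qgo-z i [] = refl
psum-qgo-z i (zero ∷ v) = +-comm (psum i (qgo z v)) _
psum-qgo-z i (suc a ∷ v) = cong suc (+-comm (psum i (qgo nz v)) a)

psum-qgo-nz : ∀ {n} i (v : Vec ℕ n) → psum i (qgo nz v) ≡ psum i v + excess i v
psum-qgo-nz zero v = refl
psum-qgo-nz (suc i) [] = refl
psum-qgo-nz (suc zero) (zero ∷ v) = +-identityʳ _
psum-qgo-nz (suc (suc i)) (zero ∷ v) =
  trans (+-comm (firstNZ v ∸ 1) _) (trans (psum-qgo-z i v) (psum-qgo-nz (suc i) v))
psum-qgo-nz (suc zero) (suc a ∷ v) = sym (+-identityʳ _)
psum-qgo-nz (suc (suc i)) (suc a ∷ v) =
  trans (cong (suc a +_) (psum-qgo-nz (suc i) v)) (sym (+-assoc (suc a) _ _))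

qgo-start : ∀ {n} (v : Vec ℕ n) → qgo start v ≡ qgo nz v
qgo-start [] = refl
qgo-start (zero ∷ v) = refl
qgo-start (suc x ∷ v) = refl

psum-qshift : ∀ {n} i (v : Vec ℕ n) → psum i (qshift v) ≡ psum i v + excess i v
psum-qshift i v = trans (cong (psum i) (qgo-start v)) (psum-qgo-nz i v)

firstNZ-zeros : ∀ {n} (v : Vec ℕ n) → nonzeros v ≡ 0 → firstNZ v ≡ 0
firstNZ-zeros [] _ = refl
firstNZ-zeros (zero ∷ v) h = firstNZ-zeros v h

qgo-zeros : ∀ {n} p (v : Vec ℕ n) → nonzeros v ≡ 0 → qgo p v ≡ v
qgo-zeros p [] _ = refl
qgo-zeros start (zero ∷ v) h = cong₂ _∷_ (cong (_∸ 1) (firstNZ-zeros v h)) (qgo-zeros z v h)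
qgo-zeros nz (zero ∷ v) h = cong₂ _∷_ (cong (_∸ 1) (firstNZ-zeros v h)) (qgo-zeros z v h)
qgo-zeros z (zero ∷ v) h = cong (0 ∷_) (qgo-zeros z v h)

qgo-nz-flat : ∀ {n} (v : Vec ℕ n) → inversions v ≡ 0 → qgo nz v ≡ v
qgo-nz-flat [] _ = refl
qgo-nz-flat (zero ∷ v) h = qgo-zeros nz (zero ∷ v) (m+n≡0⇒m≡0 (nonzeros v) h)
qgo-nz-flat (suc x ∷ v) h = cong (suc x ∷_) (qgo-nz-flat v h)

qshift-flat : ∀ {n} (v : Vec ℕ n) → inversions v ≡ 0 → qshift v ≡ v
qshift-flat v h = trans (qgo-start v) (qgo-nz-flat v h)

⊴-refl : ∀ {n} (v : Vec ℕ n) → v ⊴ v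
⊴-refl v i = ≤-refl

⊴-antisym : ∀ {n} {u v : Vec ℕ n} → u ⊴ v → v ⊴ u → u ≡ v
⊴-antisym {u = []} {[]} _ _ = refl
⊴-antisym {u = x ∷ u} {y ∷ v} u⊴v v⊴u = cong₂ _∷_ x≡y (⊴-antisym tail-⊴ tail-⊵)
  where
  x≡y : x ≡ y
  x≡y = ≤-antisym (subst₂ _≤_ (+-identityʳ x) (+-identityʳ y) (u⊴v 1))
                  (subst₂ _≤_ (+-identityʳ y) (+-identityʳ x) (v⊴u 1))
  tail-⊴ : u ⊴ v
  tail-⊴ i = +-cancelˡ-≤ x _ _ (subst (λ y′ → x + psum i u ≤ y′ + psum i v) (sym x≡y) (u⊴v (suc i)))
  tail-⊵ : v ⊴ u
  tail-⊵ i = +-cancelˡ-≤ x _ _ (subst (λ y′ → y′ + psum i v ≤ x + psum i u) (sym x≡y) (v⊴u (suc i)))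

-- The interval [α, qshift α] under the swap of an ascent

entry : ∀ {n} → ℕ → Vec ℕ n → ℕ
entry zero _ = 0
entry (suc _) [] = 0
entry (suc zero) (x ∷ _) = x
entry (suc (suc i)) (_ ∷ v) = entry (suc i) v

gatherLeft : ∀ {n} → ℕ → Vec ℕ n → Vec ℕ n
gatherLeft (suc zero) (e ∷ f ∷ v) = e + f ∷ 0 ∷ v
gatherLeft (suc (suc i)) (x ∷ v) = x ∷ gatherLeft (suc i) v
gatherLeft _ v = v

gatherRight : ∀ {n} → ℕ → Vec ℕ n → Vec ℕ n
gatherRight (suc zero) (e ∷ f ∷ v) = 0 ∷ e + f ∷ v
gatherRight (suc (suc i)) (x ∷ v) = x ∷ gatherRight (suc i) v
gatherRight _ v = v

psum-suc : ∀ {n} i (v : Vec ℕ n) → psum (suc i) v ≡ psum i v + entry (suc i) v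
psum-suc zero [] = refl
psum-suc (suc i) [] = refl
psum-suc zero (x ∷ v) = +-identityʳ x
psum-suc (suc i) (x ∷ v) = trans (cong (x +_) (psum-suc i v)) (sym (+-assoc x _ _))

psum-swapAt-≢ : ∀ {n} i j (v : Vec ℕ n) → i ≢ j → psum i (swapAt j v) ≡ psum i v
psum-swapAt-≢ zero j v _ = refl
psum-swapAt-≢ (suc i) zero v _ = refl
psum-swapAt-≢ (suc i) (suc zero) [] _ = refl
psum-swapAt-≢ (suc i) (suc (suc j)) [] _ = refl
psum-swapAt-≢ (suc zero) (suc zero) (x ∷ v) i≢j = ⊥-elim (i≢j refl)
psum-swapAt-≢ (suc (suc i)) (suc zero) (x ∷ []) _ = refl
psum-swapAt-≢ (suc (suc i)) (suc zero) (x ∷ y ∷ v) _ = begin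
  y + (x + psum i v)  ≡⟨ sym (+-assoc y x _) ⟩
  y + x + psum i v    ≡⟨ cong (_+ psum i v) (+-comm y x) ⟩
  x + y + psum i v    ≡⟨ +-assoc x y _ ⟩
  x + (y + psum i v)  ∎
  where open ≡-Reasoning
psum-swapAt-≢ (suc i) (suc (suc j)) (x ∷ v) i≢j =
  cong (x +_) (psum-swapAt-≢ i (suc j) v (i≢j ∘′ cong suc))

psum-gatherLeft-≢ : ∀ {n} i j (v : Vec ℕ n) → i ≢ j → psum i (gatherLeft j v) ≡ psum i v
psum-gatherLeft-≢ zero j v _ = refl
psum-gatherLeft-≢ (suc i) zero v _ = refl
psum-gatherLeft-≢ (suc i) (suc zero) [] _ = refl
psum-gatherLeft-≢ (suc i) (suc (suc j)) [] _ = refl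
psum-gatherLeft-≢ (suc zero) (suc zero) (x ∷ v) i≢j = ⊥-elim (i≢j refl)
psum-gatherLeft-≢ (suc (suc i)) (suc zero) (x ∷ []) _ = refl
psum-gatherLeft-≢ (suc (suc i)) (suc zero) (e ∷ f ∷ v) _ = +-assoc e f _
psum-gatherLeft-≢ (suc i) (suc (suc j)) (x ∷ v) i≢j =
  cong (x +_) (psum-gatherLeft-≢ i (suc j) v (i≢j ∘′ cong suc))

psum-gatherRight-≢ : ∀ {n} i j (v : Vec ℕ n) → i ≢ j → psum i (gatherRight j v) ≡ psum i v
psum-gatherRight-≢ zero j v _ = refl
psum-gatherRight-≢ (suc i) zero v _ = refl
psum-gatherRight-≢ (suc i) (suc zero) [] _ = refl
psum-gatherRight-≢ (suc i) (suc (suc j)) [] _ = refl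
psum-gatherRight-≢ (suc zero) (suc zero) (x ∷ v) i≢j = ⊥-elim (i≢j refl)
psum-gatherRight-≢ (suc (suc i)) (suc zero) (x ∷ []) _ = refl
psum-gatherRight-≢ (suc (suc i)) (suc zero) (e ∷ f ∷ v) _ = +-assoc e f _
psum-gatherRight-≢ (suc i) (suc (suc j)) (x ∷ v) i≢j =
  cong (x +_) (psum-gatherRight-≢ i (suc j) v (i≢j ∘′ cong suc))

psum-gatherLeft : ∀ {n} k (v : Vec ℕ n) → psum (suc k) (gatherLeft (suc k) v) ≡ psum (suc (suc k)) v
psum-gatherLeft zero [] = refl
psum-gatherLeft (suc k) [] = refl
psum-gatherLeft zero (e ∷ []) = refl
psum-gatherLeft zero (e ∷ f ∷ v) = trans (+-identityʳ _) (cong (e +_) (sym (+-identityʳ f)))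
psum-gatherLeft (suc k) (x ∷ v) = cong (x +_) (psum-gatherLeft k v)

psum-gatherRight : ∀ {n} k (v : Vec ℕ n) → suc k < n → psum (suc k) (gatherRight (suc k) v) ≡ psum k v
psum-gatherRight zero (e ∷ []) (s≤s ())
psum-gatherRight zero (e ∷ f ∷ v) _ = refl
psum-gatherRight (suc k) (x ∷ v) (s≤s k<n) = cong (x +_) (psum-gatherRight k v k<n)

ascent⇒< : ∀ {n k a} {v : Vec ℕ n} → Ascent (suc k) a v → suc k < n
ascent⇒< here = s≤s (s≤s z≤n)
ascent⇒< (there asc) = s≤s (ascent⇒< asc)

psum-ascent-zero : ∀ {n k a} {v : Vec ℕ n} → Ascent (suc k) a v → psum (suc k) v ≡ psum k v
psum-ascent-zero here = refl
psum-ascent-zero (there {x = x} asc) = cong (x +_) (psum-ascent-zero asc)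

psum-ascent-suc : ∀ {n k a} {v : Vec ℕ n} → Ascent (suc k) a v →
  psum (suc (suc k)) v ≡ psum k v + suc a
psum-ascent-suc here = +-identityʳ _
psum-ascent-suc (there {x = x} asc) = trans (cong (x +_) (psum-ascent-suc asc)) (sym (+-assoc x _ _))

psum-swapAt-ascent : ∀ {n k a} {v : Vec ℕ n} → Ascent (suc k) a v →
  psum (suc k) (swapAt (suc k) v) ≡ psum k v + suc a
psum-swapAt-ascent here = +-identityʳ _
psum-swapAt-ascent (there {x = x} asc) = trans (cong (x +_) (psum-swapAt-ascent asc)) (sym (+-assoc x _ _))

firstNZ-swapAt-ascent : ∀ {n j a} {v : Vec ℕ n} → Ascent j a v → firstNZ (swapAt j v) ≡ firstNZ v
firstNZ-swapAt-ascent here = refl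
firstNZ-swapAt-ascent (there {x = zero} asc) = firstNZ-swapAt-ascent asc
firstNZ-swapAt-ascent (there {x = suc x} asc) = refl

excess-swapAt-≢ : ∀ {n j a} {v : Vec ℕ n} → Ascent j a v → ∀ i → i ≢ j → i ≢ suc j →
  excess i (swapAt j v) ≡ excess i v
excess-swapAt-≢ here zero _ _ = refl
excess-swapAt-≢ here (suc zero) i≢j _ = ⊥-elim (i≢j refl)
excess-swapAt-≢ here (suc (suc zero)) _ i≢sj = ⊥-elim (i≢sj refl)
excess-swapAt-≢ here (suc (suc (suc i))) _ _ = refl
excess-swapAt-≢ (there asc) zero _ _ = refl
excess-swapAt-≢ (there {x = zero} asc) (suc zero) _ _ = cong (_∸ 1) (firstNZ-swapAt-ascent asc)
excess-swapAt-≢ (there {x = suc x} asc) (suc zero) _ _ = refl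
excess-swapAt-≢ (there asc) (suc (suc i)) i≢j i≢sj =
  excess-swapAt-≢ asc (suc i) (i≢j ∘′ cong suc) (i≢sj ∘′ cong suc)

excess-ascent : ∀ {n j a} {v : Vec ℕ n} → Ascent j a v → excess j v ≡ a
excess-ascent here = refl
excess-ascent (there asc) = excess-ascent asc

excess-ascent-suc : ∀ {n j a} {v : Vec ℕ n} → Ascent j a v → excess (suc j) v ≡ 0
excess-ascent-suc here = refl
excess-ascent-suc (there asc) = excess-ascent-suc asc

excess-swapAt-ascent : ∀ {n j a} {v : Vec ℕ n} → Ascent j a v → excess j (swapAt j v) ≡ 0
excess-swapAt-ascent here = refl
excess-swapAt-ascent (there asc) = excess-swapAt-ascent asc

excess-before-ascent : ∀ {n k a} {v : Vec ℕ n} → Ascent (suc k) a v → excess k v ≤ a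
excess-before-ascent here = z≤n
excess-before-ascent (there {x = zero} here) = ≤-refl
excess-before-ascent (there {x = suc x} here) = z≤n
excess-before-ascent (there (there asc)) = excess-before-ascent (there asc)

InInterval : ∀ {n} → WComp n → WComp n → Set
InInterval α β = (α ⊴ β) × (β ⊴ qshift α)

module _ {n k a} {α : Vec ℕ n} (asc : Ascent (suc k) a α) where
  private
    j = suc k
    α′ = swapAt j α
    ℓ = psum k α
    open ≤-Reasoning

    k≢j : k ≢ j
    k≢j ()

    sj≢j : suc j ≢ j
    sj≢j ()

    ℓ+suc-a≰ℓ+a : ¬ (ℓ + suc a ≤ ℓ + a)
    ℓ+suc-a≰ℓ+a h = n≮n a (+-cancelˡ-≤ ℓ (suc a) a h)

    psum-qshift-≢ : ∀ i → i ≢ j → i ≢ suc j → psum i (qshift α′) ≡ psum i (qshift α)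
    psum-qshift-≢ i i≢j i≢sj = begin-equality
      psum i (qshift α′)       ≡⟨ psum-qshift i α′ ⟩
      psum i α′ + excess i α′  ≡⟨ cong₂ _+_ (psum-swapAt-≢ i j α i≢j) (excess-swapAt-≢ asc i i≢j i≢sj) ⟩
      psum i α + excess i α    ≡⟨ psum-qshift i α ⟨
      psum i (qshift α)        ∎

    psum-qshift-at : psum j (qshift α) ≡ ℓ + a
    psum-qshift-at = trans (psum-qshift j α) (cong₂ _+_ (psum-ascent-zero asc) (excess-ascent asc))

    psum-qshift-after : psum (suc j) (qshift α) ≡ ℓ + suc a
    psum-qshift-after = begin-equality
      psum (suc j) (qshift α)             ≡⟨ psum-qshift (suc j) α ⟩
      psum (suc j) α + excess (suc j) α   ≡⟨ cong₂ _+_ (psum-ascent-suc asc) (excess-ascent-suc asc) ⟩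
      ℓ + suc a + 0                       ≡⟨ +-identityʳ _ ⟩
      ℓ + suc a                           ∎

    psum-qshift′-at : psum j (qshift α′) ≡ ℓ + suc a
    psum-qshift′-at = begin-equality
      psum j (qshift α′)          ≡⟨ psum-qshift j α′ ⟩
      psum j α′ + excess j α′     ≡⟨ cong₂ _+_ (psum-swapAt-ascent asc) (excess-swapAt-ascent asc) ⟩
      ℓ + suc a + 0               ≡⟨ +-identityʳ _ ⟩
      ℓ + suc a                   ∎

    psum-qshift-after-≤ : psum (suc j) (qshift α) ≤ psum (suc j) (qshift α′)
    psum-qshift-after-≤ = begin
      psum (suc j) (qshift α)              ≡⟨ psum-qshift (suc j) α ⟩
      psum (suc j) α + excess (suc j) α    ≡⟨ cong₂ _+_ (sym (psum-swapAt-≢ (suc j) j α sj≢j)) (excess-ascent-suc asc) ⟩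
      psum (suc j) α′ + 0                  ≤⟨ +-monoʳ-≤ (psum (suc j) α′) z≤n ⟩
      psum (suc j) α′ + excess (suc j) α′  ≡⟨ psum-qshift (suc j) α′ ⟨
      psum (suc j) (qshift α′)             ∎

  entry≡0⇒∉interval : ∀ β → entry (suc j) β ≡ 0 → ¬ InInterval α β
  entry≡0⇒∉interval β β₊≡0 (α⊴β , β⊴qα) = ℓ+suc-a≰ℓ+a (begin
    ℓ + suc a                     ≡⟨ psum-ascent-suc asc ⟨
    psum (suc j) α                ≤⟨ α⊴β (suc j) ⟩
    psum (suc j) β                ≡⟨ psum-suc j β ⟩
    psum j β + entry (suc j) β    ≡⟨ cong (psum j β +_) β₊≡0 ⟩
    psum j β + 0                  ≡⟨ +-identityʳ _ ⟩
    psum j β                      ≤⟨ β⊴qα j ⟩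
    psum j (qshift α)             ≡⟨ psum-qshift-at ⟩
    ℓ + a                         ∎)

  gatherLeft-∈interval : ∀ β → InInterval α β → InInterval α′ (gatherLeft j β)
  gatherLeft-∈interval β (α⊴β , β⊴qα) = lower , upper
    where
    lower : α′ ⊴ gatherLeft j β
    lower i with i ≟ j
    ... | yes refl = begin
      psum j α′                ≡⟨ psum-swapAt-ascent asc ⟩
      ℓ + suc a                ≡⟨ psum-ascent-suc asc ⟨
      psum (suc j) α           ≤⟨ α⊴β (suc j) ⟩
      psum (suc j) β           ≡⟨ psum-gatherLeft k β ⟨
      psum j (gatherLeft j β)  ∎
    ... | no i≢j = begin
      psum i α′                ≡⟨ psum-swapAt-≢ i j α i≢j ⟩
      psum i α                 ≤⟨ α⊴β i ⟩
      psum i β                 ≡⟨ psum-gatherLeft-≢ i j β i≢j ⟨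
      psum i (gatherLeft j β)  ∎
    upper : gatherLeft j β ⊴ qshift α′
    upper i with i ≟ j | i ≟ suc j
    ... | yes refl | _ = begin
      psum j (gatherLeft j β)   ≡⟨ psum-gatherLeft k β ⟩
      psum (suc j) β            ≤⟨ β⊴qα (suc j) ⟩
      psum (suc j) (qshift α)   ≡⟨ psum-qshift-after ⟩
      ℓ + suc a                 ≡⟨ psum-qshift′-at ⟨
      psum j (qshift α′)        ∎
    ... | no _ | yes refl = begin
      psum (suc j) (gatherLeft j β)  ≡⟨ psum-gatherLeft-≢ (suc j) j β sj≢j ⟩
      psum (suc j) β                 ≤⟨ β⊴qα (suc j) ⟩
      psum (suc j) (qshift α)        ≤⟨ psum-qshift-after-≤ ⟩
      psum (suc j) (qshift α′)       ∎
    ... | no i≢j | no i≢sj = begin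
      psum i (gatherLeft j β)   ≡⟨ psum-gatherLeft-≢ i j β i≢j ⟩
      psum i β                  ≤⟨ β⊴qα i ⟩
      psum i (qshift α)         ≡⟨ psum-qshift-≢ i i≢j i≢sj ⟨
      psum i (qshift α′)        ∎

  gatherLeft-∈interval⁻¹ : ∀ β → entry (suc j) β ≢ 0 → InInterval α′ (gatherLeft j β) → InInterval α β
  gatherLeft-∈interval⁻¹ β β₊≢0 (α′⊴β′ , β′⊴qα′) = lower , upper
    where
    after≤ : psum (suc j) β ≤ ℓ + suc a
    after≤ = begin
      psum (suc j) β             ≡⟨ psum-gatherLeft k β ⟨
      psum j (gatherLeft j β)    ≤⟨ β′⊴qα′ j ⟩
      psum j (qshift α′)         ≡⟨ psum-qshift′-at ⟩
      ℓ + suc a                  ∎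
    lower : α ⊴ β
    lower i with i ≟ j
    ... | yes refl = begin
      psum j α                  ≡⟨ psum-ascent-zero asc ⟩
      ℓ                         ≡⟨ psum-swapAt-≢ k j α k≢j ⟨
      psum k α′                 ≤⟨ α′⊴β′ k ⟩
      psum k (gatherLeft j β)   ≡⟨ psum-gatherLeft-≢ k j β k≢j ⟩
      psum k β                  ≤⟨ m≤m+n (psum k β) (entry j β) ⟩
      psum k β + entry j β      ≡⟨ psum-suc k β ⟨
      psum j β                  ∎
    ... | no i≢j = begin
      psum i α                  ≡⟨ psum-swapAt-≢ i j α i≢j ⟨
      psum i α′                 ≤⟨ α′⊴β′ i ⟩
      psum i (gatherLeft j β)   ≡⟨ psum-gatherLeft-≢ i j β i≢j ⟩
      psum i β                  ∎
    upper : β ⊴ qshift α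
    upper i with i ≟ j | i ≟ suc j
    ... | yes refl | _ = ≤-pred (begin
      suc (psum j β)                ≡⟨ +-comm 1 (psum j β) ⟩
      psum j β + 1                  ≤⟨ +-monoʳ-≤ (psum j β) (n≢0⇒n>0 β₊≢0) ⟩
      psum j β + entry (suc j) β    ≡⟨ psum-suc j β ⟨
      psum (suc j) β                ≤⟨ after≤ ⟩
      ℓ + suc a                     ≡⟨ +-suc ℓ a ⟩
      suc (ℓ + a)                   ≡⟨ cong suc psum-qshift-at ⟨
      suc (psum j (qshift α))       ∎)
    ... | no _ | yes refl = begin
      psum (suc j) β            ≤⟨ after≤ ⟩
      ℓ + suc a                 ≡⟨ psum-qshift-after ⟨
      psum (suc j) (qshift α)   ∎
    ... | no i≢j | no i≢sj = begin
      psum i β                  ≡⟨ psum-gatherLeft-≢ i j β i≢j ⟨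
      psum i (gatherLeft j β)   ≤⟨ β′⊴qα′ i ⟩
      psum i (qshift α′)        ≡⟨ psum-qshift-≢ i i≢j i≢sj ⟩
      psum i (qshift α)         ∎

  gatherRight-∉interval : ∀ β → ¬ InInterval α′ (gatherRight j β)
  gatherRight-∉interval β (α′⊴β′ , β′⊴qα′) = ℓ+suc-a≰ℓ+a (begin
    ℓ + suc a                   ≡⟨ psum-swapAt-ascent asc ⟨
    psum j α′                   ≤⟨ α′⊴β′ j ⟩
    psum j (gatherRight j β)    ≡⟨ psum-gatherRight k β (ascent⇒< asc) ⟩
    psum k β                    ≡⟨ psum-gatherRight-≢ k j β k≢j ⟨
    psum k (gatherRight j β)    ≤⟨ β′⊴qα′ k ⟩
    psum k (qshift α′)          ≡⟨ psum-qshift k α′ ⟩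
    psum k α′ + excess k α′     ≡⟨ cong₂ _+_ (psum-swapAt-≢ k j α k≢j) (excess-swapAt-≢ asc k k≢j (λ ())) ⟩
    ℓ + excess k α              ≤⟨ +-monoʳ-≤ ℓ (excess-before-ascent asc) ⟩
    ℓ + a                       ∎)

module Coefficients {A : Set} (_≟ᴬ_ : DecidableEquality A) where

  coeffOf : List (ℤ × A) → A → ℤ
  coeffOf [] t = 0ℤ
  coeffOf ((c , x) ∷ p) t with x ≟ᴬ t
  ... | yes _ = c +ℤ coeffOf p t
  ... | no _ = coeffOf p t

  coeffOf-hit : ∀ c t p → coeffOf ((c , t) ∷ p) t ≡ c +ℤ coeffOf p t
  coeffOf-hit c t p with t ≟ᴬ t
  ... | yes _ = refl
  ... | no t≢t = ⊥-elim (t≢t refl)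

  coeffOf-miss : ∀ c x t p → x ≢ t → coeffOf ((c , x) ∷ p) t ≡ coeffOf p t
  coeffOf-miss c x t p x≢t with x ≟ᴬ t
  ... | yes x≡t = ⊥-elim (x≢t x≡t)
  ... | no _ = refl

  coeffOf-single-miss : ∀ c x t → x ≢ t → coeffOf [ (c , x) ] t ≡ 0ℤ
  coeffOf-single-miss c x t = coeffOf-miss c x t []

  coeffOf-single-neg : ∀ c x t → coeffOf [ (- c , x) ] t ≡ - coeffOf [ (c , x) ] t
  coeffOf-single-neg c x t with x ≟ᴬ t
  ... | yes _ = trans (ℤ.+-identityʳ (- c)) (cong -_ (sym (ℤ.+-identityʳ c)))
  ... | no _ = refl

  coeffOf-single-cong : ∀ c {x t y u} → (x ≡ t → y ≡ u) → (y ≡ u → x ≡ t) →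
    coeffOf [ (c , x) ] t ≡ coeffOf [ (c , y) ] u
  coeffOf-single-cong c {x} {t} {y} {u} to from with x ≟ᴬ t | y ≟ᴬ u
  ... | yes _ | yes _ = refl
  ... | no _ | no _ = refl
  ... | yes x≡t | no y≢u = ⊥-elim (y≢u (to x≡t))
  ... | no x≢t | yes y≡u = ⊥-elim (x≢t (from y≡u))

  coeffOf-++ : ∀ p q t → coeffOf (p ++ q) t ≡ coeffOf p t +ℤ coeffOf q t
  coeffOf-++ [] q t = sym (ℤ.+-identityˡ _)
  coeffOf-++ ((c , x) ∷ p) q t with x ≟ᴬ t
  ... | yes _ = trans (cong (c +ℤ_) (coeffOf-++ p q t)) (sym (ℤ.+-assoc c _ _))
  ... | no _ = coeffOf-++ p q t

  coeffOf-cancel : ∀ c x t → coeffOf ((c , x) ∷ (- c , x) ∷ []) t ≡ 0ℤ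
  coeffOf-cancel c x t with x ≟ᴬ t
  ... | yes refl = begin
    c +ℤ coeffOf [ (- c , x) ] x  ≡⟨ cong (c +ℤ_) (coeffOf-hit (- c) x []) ⟩
    c +ℤ (- c +ℤ 0ℤ)              ≡⟨ cong (c +ℤ_) (ℤ.+-identityʳ (- c)) ⟩
    c +ℤ - c                      ≡⟨ ℤ.+-inverseʳ c ⟩
    0ℤ                            ∎
    where open ≡-Reasoning
  ... | no x≢t = coeffOf-single-miss (- c) x t x≢t

  coeffOf-scale : ∀ c p t → coeffOf (map (map₁ (c *ℤ_)) p) t ≡ c *ℤ coeffOf p t
  coeffOf-scale c [] t = sym (ℤ.*-zeroʳ c)
  coeffOf-scale c ((d , x) ∷ p) t with x ≟ᴬ t
  ... | yes _ = trans (cong (c *ℤ d +ℤ_) (coeffOf-scale c p t)) (sym (ℤ.*-distribˡ-+ c d _))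
  ... | no _ = coeffOf-scale c p t

  coeffOf-∷ : ∀ c x p t → coeffOf ((c , x) ∷ p) t ≡ c *ℤ coeffOf [ (1ℤ , x) ] t +ℤ coeffOf p t
  coeffOf-∷ c x p t with x ≟ᴬ t
  ... | yes _ = cong (_+ℤ coeffOf p t) (sym (ℤ.*-identityʳ c))
  ... | no _ = sym (trans (cong (_+ℤ coeffOf p t) (ℤ.*-zeroʳ c)) (ℤ.+-identityˡ _))

  coeffOf-applyUpTo-none : ∀ c (F : ℕ → A) N t → (∀ k → k < N → F k ≢ t) →
    coeffOf (applyUpTo (λ k → (c , F k)) N) t ≡ 0ℤ
  coeffOf-applyUpTo-none c F zero t _ = refl
  coeffOf-applyUpTo-none c F (suc N) t h =
    trans (coeffOf-miss c (F 0) t _ (h 0 z<s))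
          (coeffOf-applyUpTo-none c (F ∘′ suc) N t (λ k k<N → h (suc k) (s<s k<N)))

  coeffOf-applyUpTo-unique : ∀ c (F : ℕ → A) N κ t → κ < N → (∀ k → F k ≡ t → k ≡ κ) →
    coeffOf (applyUpTo (λ k → (c , F k)) N) t ≡ coeffOf [ (c , F κ) ] t
  coeffOf-applyUpTo-unique c F (suc N) zero t _ only-κ = begin
    coeffOf ((c , F 0) ∷ applyUpTo (λ k → (c , F (suc k))) N) t
      ≡⟨ coeffOf-∷ c (F 0) _ t ⟩
    c *ℤ coeffOf [ (1ℤ , F 0) ] t +ℤ coeffOf (applyUpTo (λ k → (c , F (suc k))) N) t
      ≡⟨ cong (c *ℤ coeffOf [ (1ℤ , F 0) ] t +ℤ_) rest≡0 ⟩
    c *ℤ coeffOf [ (1ℤ , F 0) ] t +ℤ 0ℤ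
      ≡⟨ coeffOf-∷ c (F 0) [] t ⟨
    coeffOf [ (c , F 0) ] t ∎
    where
    open ≡-Reasoning
    rest≡0 = coeffOf-applyUpTo-none c (F ∘′ suc) N t (λ k _ Fsk≡t → 0≢1+n (sym (only-κ (suc k) Fsk≡t)))
  coeffOf-applyUpTo-unique c F (suc N) (suc κ) t (s<s κ<N) only-κ =
    trans (coeffOf-miss c (F 0) t _ (λ F0≡t → 0≢1+n (only-κ 0 F0≡t)))
          (coeffOf-applyUpTo-unique c (F ∘′ suc) N κ t κ<N (λ k Fsk≡t → suc-injective (only-κ (suc k) Fsk≡t)))

module _ {A B : Set} (_≟ᴬ_ : DecidableEquality A) (_≟ᴮ_ : DecidableEquality B)
         (emb : A → B) (emb-injective : Injective _≡_ _≡_ emb) where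
  private
    module A = Coefficients _≟ᴬ_
    module B = Coefficients _≟ᴮ_

  coeffOf-map-injective : ∀ p t → B.coeffOf (map (map₂ emb) p) (emb t) ≡ A.coeffOf p t
  coeffOf-map-injective [] t = refl
  coeffOf-map-injective ((c , x) ∷ p) t with x ≟ᴬ t
  ... | yes refl = trans (B.coeffOf-hit c (emb x) _) (cong (c +ℤ_) (coeffOf-map-injective p t))
  ... | no x≢t = trans (B.coeffOf-miss c (emb x) (emb t) _ (x≢t ∘′ emb-injective)) (coeffOf-map-injective p t)

  coeffOf-map-∉ : ∀ p t → (∀ x → emb x ≢ t) → B.coeffOf (map (map₂ emb) p) t ≡ 0ℤ
  coeffOf-map-∉ [] t _ = refl
  coeffOf-map-∉ ((c , x) ∷ p) t ∉ = trans (B.coeffOf-miss c (emb x) t _ (∉ x)) (coeffOf-map-∉ p t ∉)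

-- Coefficients of θ̃

_≟²_ : DecidableEquality (ℕ × ℕ)
_≟²_ = ×-≡-dec _≟_ _≟_

_≟ᵛ_ : ∀ {n} → DecidableEquality (Vec ℕ n)
_≟ᵛ_ = Vec.≡-dec _≟_

module Pair = Coefficients _≟²_
open module VecCoefficients {n} = Coefficients (Vec.≡-dec {n = n} _≟_)

coeff≗coeffOf : ∀ {n} (p : Poly n) γ → coeff p γ ≡ coeffOf p γ
coeff≗coeffOf [] γ = refl
coeff≗coeffOf ((c , δ) ∷ p) γ with Vec.≡-dec _≟_ δ γ
... | yes _ = cong (c +ℤ_) (coeff≗coeffOf p γ)
... | no _ = coeff≗coeffOf p γ

thetaPair-suc-zero : ∀ a →
  thetaPair (suc a) 0 ≡ applyUpTo (λ k → (1ℤ , suc a ∸ k , k)) (suc (suc a)) ++ [ (-1ℤ , suc a , 0) ]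
thetaPair-suc-zero a = cong (_++ [ (-1ℤ , suc a , 0) ]) (map-upTo _ (suc (suc a)))

thetaPair-zero-suc : ∀ b →
  thetaPair 0 (suc b) ≡ applyUpTo (λ k → (-1ℤ , suc k , b ∸ k)) b ++ [ (-1ℤ , 0 , suc b) ]
thetaPair-zero-suc zero = refl
thetaPair-zero-suc (suc b) = cong (_++ [ (-1ℤ , 0 , suc (suc b)) ]) (map-upTo _ (suc b))

0≢m+[1+n] : ∀ e f → 0 ≢ e + suc f
0≢m+[1+n] e f eq = 0≢1+n (trans eq (+-suc e f))

thetaPair-coeff-zero : ∀ g₁ g₂ e → Pair.coeffOf (thetaPair g₁ g₂) (e , 0) ≡ 0ℤ
thetaPair-coeff-zero zero zero e = Pair.coeffOf-cancel 1ℤ (0 , 0) (e , 0)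
thetaPair-coeff-zero (suc a) (suc b) e = Pair.coeffOf-cancel 1ℤ (suc a , suc b) (e , 0)
thetaPair-coeff-zero (suc a) zero e = begin
  Pair.coeffOf (thetaPair (suc a) 0) (e , 0)
    ≡⟨ cong (λ p → Pair.coeffOf p (e , 0)) (thetaPair-suc-zero a) ⟩
  Pair.coeffOf (antidiagonal ++ [ (-1ℤ , suc a , 0) ]) (e , 0)
    ≡⟨ Pair.coeffOf-++ antidiagonal _ (e , 0) ⟩
  Pair.coeffOf antidiagonal (e , 0) +ℤ Pair.coeffOf [ (-1ℤ , suc a , 0) ] (e , 0)
    ≡⟨ cong (_+ℤ Pair.coeffOf [ (-1ℤ , suc a , 0) ] (e , 0))
         (Pair.coeffOf-applyUpTo-unique 1ℤ (λ k → suc a ∸ k , k) (suc (suc a)) 0 (e , 0) z<s (λ k → cong proj₂)) ⟩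
  Pair.coeffOf [ (1ℤ , suc a , 0) ] (e , 0) +ℤ Pair.coeffOf [ (-1ℤ , suc a , 0) ] (e , 0)
    ≡⟨ Pair.coeffOf-++ [ (1ℤ , suc a , 0) ] _ (e , 0) ⟨
  Pair.coeffOf ((1ℤ , suc a , 0) ∷ (-1ℤ , suc a , 0) ∷ []) (e , 0)
    ≡⟨ Pair.coeffOf-cancel 1ℤ (suc a , 0) (e , 0) ⟩
  0ℤ ∎
  where
  open ≡-Reasoning
  antidiagonal = applyUpTo (λ k → (1ℤ , suc a ∸ k , k)) (suc (suc a))
thetaPair-coeff-zero zero (suc b) e = begin
  Pair.coeffOf (thetaPair 0 (suc b)) (e , 0)
    ≡⟨ cong (λ p → Pair.coeffOf p (e , 0)) (thetaPair-zero-suc b) ⟩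
  Pair.coeffOf (applyUpTo (λ k → (-1ℤ , suc k , b ∸ k)) b ++ [ (-1ℤ , 0 , suc b) ]) (e , 0)
    ≡⟨ Pair.coeffOf-++ (applyUpTo (λ k → (-1ℤ , suc k , b ∸ k)) b) _ (e , 0) ⟩
  Pair.coeffOf (applyUpTo (λ k → (-1ℤ , suc k , b ∸ k)) b) (e , 0) +ℤ Pair.coeffOf [ (-1ℤ , 0 , suc b) ] (e , 0)
    ≡⟨ cong₂ _+ℤ_ (Pair.coeffOf-applyUpTo-none -1ℤ (λ k → suc k , b ∸ k) b (e , 0) (λ k k<b → m>n⇒m∸n≢0 k<b ∘′ cong proj₂))
                  (Pair.coeffOf-single-miss -1ℤ (0 , suc b) (e , 0) (λ eq → 0≢1+n (sym (cong proj₂ eq)))) ⟩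
  0ℤ +ℤ 0ℤ ∎
  where open ≡-Reasoning

thetaPair-coeff-suc : ∀ g₁ g₂ e f →
  Pair.coeffOf (thetaPair g₁ g₂) (e , suc f)
    ≡ Pair.coeffOf [ (1ℤ , g₁ , g₂) ] (e + suc f , 0) -ℤ Pair.coeffOf [ (1ℤ , g₁ , g₂) ] (0 , e + suc f)
thetaPair-coeff-suc zero zero e f = begin
  Pair.coeffOf (thetaPair 0 0) (e , suc f)
    ≡⟨ Pair.coeffOf-cancel 1ℤ (0 , 0) (e , suc f) ⟩
  0ℤ -ℤ 0ℤ
    ≡⟨ cong₂ _-ℤ_ (Pair.coeffOf-single-miss 1ℤ (0 , 0) (e + suc f , 0) (0≢m+[1+n] e f ∘′ cong proj₁))
                  (Pair.coeffOf-single-miss 1ℤ (0 , 0) (0 , e + suc f) (0≢m+[1+n] e f ∘′ cong proj₂)) ⟨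
  Pair.coeffOf [ (1ℤ , 0 , 0) ] (e + suc f , 0) -ℤ Pair.coeffOf [ (1ℤ , 0 , 0) ] (0 , e + suc f) ∎
  where open ≡-Reasoning
thetaPair-coeff-suc (suc a) (suc b) e f = begin
  Pair.coeffOf (thetaPair (suc a) (suc b)) (e , suc f)
    ≡⟨ Pair.coeffOf-cancel 1ℤ (suc a , suc b) (e , suc f) ⟩
  0ℤ -ℤ 0ℤ
    ≡⟨ cong₂ _-ℤ_ (Pair.coeffOf-single-miss 1ℤ (suc a , suc b) (e + suc f , 0) (0≢1+n ∘′ sym ∘′ cong proj₂))
                  (Pair.coeffOf-single-miss 1ℤ (suc a , suc b) (0 , e + suc f) (0≢1+n ∘′ sym ∘′ cong proj₁)) ⟨
  Pair.coeffOf [ (1ℤ , suc a , suc b) ] (e + suc f , 0) -ℤ Pair.coeffOf [ (1ℤ , suc a , suc b) ] (0 , e + suc f) ∎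
  where open ≡-Reasoning
thetaPair-coeff-suc (suc a) zero e f = begin
  Pair.coeffOf (thetaPair (suc a) 0) t
    ≡⟨ cong (λ p → Pair.coeffOf p t) (thetaPair-suc-zero a) ⟩
  Pair.coeffOf (antidiagonal ++ [ (-1ℤ , suc a , 0) ]) t
    ≡⟨ Pair.coeffOf-++ antidiagonal _ t ⟩
  Pair.coeffOf antidiagonal t +ℤ Pair.coeffOf [ (-1ℤ , suc a , 0) ] t
    ≡⟨ cong₂ _+ℤ_ on-antidiagonal (Pair.coeffOf-single-miss -1ℤ (suc a , 0) t (0≢1+n ∘′ cong proj₂)) ⟩
  Pair.coeffOf [ (1ℤ , suc a , 0) ] (e + suc f , 0) +ℤ 0ℤ
    ≡⟨ cong (Pair.coeffOf [ (1ℤ , suc a , 0) ] (e + suc f , 0) -ℤ_)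
            (Pair.coeffOf-single-miss 1ℤ (suc a , 0) (0 , e + suc f) (0≢1+n ∘′ sym ∘′ cong proj₁)) ⟨
  Pair.coeffOf [ (1ℤ , suc a , 0) ] (e + suc f , 0) -ℤ Pair.coeffOf [ (1ℤ , suc a , 0) ] (0 , e + suc f) ∎
  where
  open ≡-Reasoning
  t = (e , suc f)
  antidiagonal = applyUpTo (λ k → (1ℤ , suc a ∸ k , k)) (suc (suc a))
  on-antidiagonal : Pair.coeffOf antidiagonal t ≡ Pair.coeffOf [ (1ℤ , suc a , 0) ] (e + suc f , 0)
  on-antidiagonal with f ≤? a
  ... | yes f≤a =
    trans (Pair.coeffOf-applyUpTo-unique 1ℤ (λ k → suc a ∸ k , k) (suc (suc a)) (suc f) t (s≤s (s≤s f≤a)) (λ k → cong proj₂))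
          (Pair.coeffOf-single-cong 1ℤ to from)
    where
    to : (a ∸ f , suc f) ≡ t → (suc a , 0) ≡ (e + suc f , 0)
    to eq = cong (_, 0) (begin
      suc a            ≡⟨ cong suc (m∸n+n≡m f≤a) ⟨
      suc (a ∸ f + f)  ≡⟨ cong (λ x → suc (x + f)) (cong proj₁ eq) ⟩
      suc (e + f)      ≡⟨ +-suc e f ⟨
      e + suc f        ∎)
    from : (suc a , 0) ≡ (e + suc f , 0) → (a ∸ f , suc f) ≡ t
    from eq = cong (_, suc f) (trans (cong (_∸ f) (suc-injective (trans (cong proj₁ eq) (+-suc e f)))) (m+n∸n≡m e f))
  ... | no f≰a =
    trans (Pair.coeffOf-applyUpTo-none 1ℤ (λ k → suc a ∸ k , k) (suc (suc a)) t
             (λ k k<N eq → f≰a (≤-pred (≤-pred (subst (_< suc (suc a)) (cong proj₂ eq) k<N)))))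
          (sym (Pair.coeffOf-single-miss 1ℤ (suc a , 0) (e + suc f , 0)
             (λ eq → f≰a (≤-pred (subst (suc f ≤_) (sym (cong proj₁ eq)) (m≤n+m (suc f) e))))))
thetaPair-coeff-suc zero (suc b) zero f = begin
  Pair.coeffOf (thetaPair 0 (suc b)) t
    ≡⟨ cong (λ p → Pair.coeffOf p t) (thetaPair-zero-suc b) ⟩
  Pair.coeffOf (column ++ [ (-1ℤ , 0 , suc b) ]) t
    ≡⟨ Pair.coeffOf-++ column _ t ⟩
  Pair.coeffOf column t +ℤ Pair.coeffOf [ (-1ℤ , 0 , suc b) ] t
    ≡⟨ cong₂ _+ℤ_ (Pair.coeffOf-applyUpTo-none -1ℤ (λ k → suc k , b ∸ k) b t (λ k _ eq → 0≢1+n (sym (cong proj₁ eq))))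
                  (Pair.coeffOf-single-neg 1ℤ (0 , suc b) t) ⟩
  0ℤ -ℤ Pair.coeffOf [ (1ℤ , 0 , suc b) ] t
    ≡⟨ cong (_-ℤ Pair.coeffOf [ (1ℤ , 0 , suc b) ] t)
            (Pair.coeffOf-single-miss 1ℤ (0 , suc b) (suc f , 0) (0≢1+n ∘′ sym ∘′ cong proj₂)) ⟨
  Pair.coeffOf [ (1ℤ , 0 , suc b) ] (suc f , 0) -ℤ Pair.coeffOf [ (1ℤ , 0 , suc b) ] t ∎
  where
  open ≡-Reasoning
  t = (0 , suc f)
  column = applyUpTo (λ k → (-1ℤ , suc k , b ∸ k)) b
thetaPair-coeff-suc zero (suc b) (suc e) f = begin
  Pair.coeffOf (thetaPair 0 (suc b)) t
    ≡⟨ cong (λ p → Pair.coeffOf p t) (thetaPair-zero-suc b) ⟩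
  Pair.coeffOf (column ++ [ (-1ℤ , 0 , suc b) ]) t
    ≡⟨ Pair.coeffOf-++ column _ t ⟩
  Pair.coeffOf column t +ℤ Pair.coeffOf [ (-1ℤ , 0 , suc b) ] t
    ≡⟨ cong₂ _+ℤ_ on-column (Pair.coeffOf-single-miss -1ℤ (0 , suc b) t (0≢1+n ∘′ cong proj₁)) ⟩
  - onAxis +ℤ 0ℤ
    ≡⟨ ℤ.+-identityʳ (- onAxis) ⟩
  - onAxis
    ≡⟨ ℤ.+-identityˡ (- onAxis) ⟨
  0ℤ -ℤ onAxis
    ≡⟨ cong (_-ℤ onAxis) (Pair.coeffOf-single-miss 1ℤ (0 , suc b) (suc e + suc f , 0) (0≢1+n ∘′ sym ∘′ cong proj₂)) ⟨
  Pair.coeffOf [ (1ℤ , 0 , suc b) ] (suc e + suc f , 0) -ℤ onAxis ∎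
  where
  open ≡-Reasoning
  t = (suc e , suc f)
  column = applyUpTo (λ k → (-1ℤ , suc k , b ∸ k)) b
  onAxis = Pair.coeffOf [ (1ℤ , 0 , suc b) ] (0 , suc e + suc f)
  on-column : Pair.coeffOf column t ≡ - onAxis
  on-column with e <? b
  ... | yes e<b =
    trans (Pair.coeffOf-applyUpTo-unique -1ℤ (λ k → suc k , b ∸ k) b e t e<b (λ k → suc-injective ∘′ cong proj₁))
          (trans (Pair.coeffOf-single-neg 1ℤ (suc e , b ∸ e) t) (cong -_ (Pair.coeffOf-single-cong 1ℤ to from)))
    where
    to : (suc e , b ∸ e) ≡ t → (0 , suc b) ≡ (0 , suc e + suc f)
    to eq = cong (λ x → 0 , suc x) (trans (sym (m+[n∸m]≡n (<⇒≤ e<b))) (cong (e +_) (cong proj₂ eq)))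
    from : (0 , suc b) ≡ (0 , suc e + suc f) → (suc e , b ∸ e) ≡ t
    from eq = cong (suc e ,_) (trans (cong (_∸ e) (suc-injective (cong proj₂ eq))) (m+n∸m≡n e (suc f)))
  ... | no e≮b =
    trans (Pair.coeffOf-applyUpTo-none -1ℤ (λ k → suc k , b ∸ k) b t
             (λ k k<b eq → e≮b (subst (_< b) (suc-injective (cong proj₁ eq)) k<b)))
          (sym (cong -_ (Pair.coeffOf-single-miss 1ℤ (0 , suc b) (0 , suc e + suc f)
             (λ eq → e≮b (subst (e <_) (sym (suc-injective (cong proj₂ eq))) (m<m+n e z<s))))))

prepend₂ : ∀ {n} → Vec ℕ n → ℕ × ℕ → Vec ℕ (suc (suc n))
prepend₂ γ (x , y) = x ∷ y ∷ γ

prepend₂-injective : ∀ {n} (γ : Vec ℕ n) → Injective _≡_ _≡_ (prepend₂ γ)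
prepend₂-injective γ eq = cong₂ _,_ (∷-injectiveˡ eq) (∷-injectiveˡ (∷-injectiveʳ eq))

liftAt-thetaPair-coeff-zero : ∀ {n} k (γ β : Vec ℕ n) → suc k < n → entry (suc (suc k)) β ≡ 0 →
  coeffOf (liftAt (suc k) thetaPair γ) β ≡ 0ℤ
liftAt-thetaPair-coeff-zero zero (g ∷ []) _ (s≤s ())
liftAt-thetaPair-coeff-zero zero (g₁ ∷ g₂ ∷ γ) (e ∷ .0 ∷ β) _ refl = by-tail (γ ≟ᵛ β)
  where
  by-tail : Dec (γ ≡ β) → coeffOf (liftAt 1 thetaPair (g₁ ∷ g₂ ∷ γ)) (e ∷ 0 ∷ β) ≡ 0ℤ
  by-tail (yes refl) =
    trans (coeffOf-map-injective _≟²_ _≟ᵛ_ (prepend₂ γ) (prepend₂-injective γ) (thetaPair g₁ g₂) (e , 0))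
          (thetaPair-coeff-zero g₁ g₂ e)
  by-tail (no γ≢β) = coeffOf-map-∉ _≟²_ _≟ᵛ_ (prepend₂ γ) (prepend₂-injective γ) (thetaPair g₁ g₂) _
                       (λ _ eq → γ≢β (∷-injectiveʳ (∷-injectiveʳ eq)))
liftAt-thetaPair-coeff-zero (suc k) (g ∷ γ) (b ∷ β) (s≤s k<n) β₊≡0 = by-head (g ≟ b)
  where
  by-head : Dec (g ≡ b) → coeffOf (liftAt (suc (suc k)) thetaPair (g ∷ γ)) (b ∷ β) ≡ 0ℤ
  by-head (yes refl) =
    trans (coeffOf-map-injective _≟ᵛ_ _≟ᵛ_ (g ∷_) ∷-injectiveʳ (liftAt (suc k) thetaPair γ) β)
          (liftAt-thetaPair-coeff-zero k γ β k<n β₊≡0)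
  by-head (no g≢b) = coeffOf-map-∉ _≟ᵛ_ _≟ᵛ_ (g ∷_) ∷-injectiveʳ (liftAt (suc k) thetaPair γ) _
                       (λ _ eq → g≢b (∷-injectiveˡ eq))

liftAt-thetaPair-coeff-suc : ∀ {n} k (γ β : Vec ℕ n) → suc k < n → entry (suc (suc k)) β ≢ 0 →
  coeffOf (liftAt (suc k) thetaPair γ) β
    ≡ coeffOf (mono γ) (gatherLeft (suc k) β) -ℤ coeffOf (mono γ) (gatherRight (suc k) β)
liftAt-thetaPair-coeff-suc zero (g ∷ []) _ (s≤s ())
liftAt-thetaPair-coeff-suc zero (g₁ ∷ g₂ ∷ γ) (e ∷ zero ∷ β) _ β₊≢0 = ⊥-elim (β₊≢0 refl)
liftAt-thetaPair-coeff-suc zero (g₁ ∷ g₂ ∷ γ) (e ∷ suc f ∷ β) _ _ = by-tail (γ ≟ᵛ β)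
  where
  relabel = coeffOf-map-injective _≟²_ _≟ᵛ_ (prepend₂ γ) (prepend₂-injective γ)
  by-tail : Dec (γ ≡ β) →
    coeffOf (liftAt 1 thetaPair (g₁ ∷ g₂ ∷ γ)) (e ∷ suc f ∷ β)
      ≡ coeffOf (mono (g₁ ∷ g₂ ∷ γ)) (e + suc f ∷ 0 ∷ β) -ℤ coeffOf (mono (g₁ ∷ g₂ ∷ γ)) (0 ∷ e + suc f ∷ β)
  by-tail (yes refl) = begin
    coeffOf (liftAt 1 thetaPair (g₁ ∷ g₂ ∷ γ)) (prepend₂ γ (e , suc f))
      ≡⟨ relabel (thetaPair g₁ g₂) (e , suc f) ⟩
    Pair.coeffOf (thetaPair g₁ g₂) (e , suc f)
      ≡⟨ thetaPair-coeff-suc g₁ g₂ e f ⟩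
    Pair.coeffOf [ (1ℤ , g₁ , g₂) ] (e + suc f , 0) -ℤ Pair.coeffOf [ (1ℤ , g₁ , g₂) ] (0 , e + suc f)
      ≡⟨ cong₂ _-ℤ_ (relabel [ (1ℤ , g₁ , g₂) ] (e + suc f , 0)) (relabel [ (1ℤ , g₁ , g₂) ] (0 , e + suc f)) ⟨
    coeffOf (mono (g₁ ∷ g₂ ∷ γ)) (e + suc f ∷ 0 ∷ γ) -ℤ coeffOf (mono (g₁ ∷ g₂ ∷ γ)) (0 ∷ e + suc f ∷ γ) ∎
    where open ≡-Reasoning
  by-tail (no γ≢β) =
    trans (absent (thetaPair g₁ g₂)) (sym (cong₂ _-ℤ_ (absent [ (1ℤ , g₁ , g₂) ]) (absent [ (1ℤ , g₁ , g₂) ])))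
    where
    absent : ∀ p {x y} → coeffOf (map (map₂ (prepend₂ γ)) p) (x ∷ y ∷ β) ≡ 0ℤ
    absent p = coeffOf-map-∉ _≟²_ _≟ᵛ_ (prepend₂ γ) (prepend₂-injective γ) p _
                 (λ _ eq → γ≢β (∷-injectiveʳ (∷-injectiveʳ eq)))
liftAt-thetaPair-coeff-suc (suc k) (g ∷ γ) (b ∷ β) (s≤s k<n) β₊≢0 = by-head (g ≟ b)
  where
  relabel = coeffOf-map-injective _≟ᵛ_ _≟ᵛ_ (g ∷_) ∷-injectiveʳ
  by-head : Dec (g ≡ b) →
    coeffOf (liftAt (suc (suc k)) thetaPair (g ∷ γ)) (b ∷ β)
      ≡ coeffOf (mono (g ∷ γ)) (b ∷ gatherLeft (suc k) β) -ℤ coeffOf (mono (g ∷ γ)) (b ∷ gatherRight (suc k) β)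
  by-head (yes refl) = begin
    coeffOf (liftAt (suc (suc k)) thetaPair (g ∷ γ)) (g ∷ β)
      ≡⟨ relabel (liftAt (suc k) thetaPair γ) β ⟩
    coeffOf (liftAt (suc k) thetaPair γ) β
      ≡⟨ liftAt-thetaPair-coeff-suc k γ β k<n β₊≢0 ⟩
    coeffOf (mono γ) (gatherLeft (suc k) β) -ℤ coeffOf (mono γ) (gatherRight (suc k) β)
      ≡⟨ cong₂ _-ℤ_ (relabel (mono γ) (gatherLeft (suc k) β)) (relabel (mono γ) (gatherRight (suc k) β)) ⟨
    coeffOf (mono (g ∷ γ)) (g ∷ gatherLeft (suc k) β) -ℤ coeffOf (mono (g ∷ γ)) (g ∷ gatherRight (suc k) β) ∎
    where open ≡-Reasoning
  by-head (no g≢b) =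
    trans (absent (liftAt (suc k) thetaPair γ) β) (sym (cong₂ _-ℤ_ (absent (mono γ) _) (absent (mono γ) _)))
    where
    absent : ∀ p w → coeffOf (map (map₂ (g ∷_)) p) (b ∷ w) ≡ 0ℤ
    absent p w = coeffOf-map-∉ _≟ᵛ_ _≟ᵛ_ (g ∷_) ∷-injectiveʳ p _ (λ _ eq → g≢b (∷-injectiveˡ eq))

coeffOf-linear : ∀ {n} (f : WComp n → Poly n) p β β₁ β₂ →
  (∀ γ → coeffOf (f γ) β ≡ coeffOf (mono γ) β₁ -ℤ coeffOf (mono γ) β₂) →
  coeffOf (linear f p) β ≡ coeffOf p β₁ -ℤ coeffOf p β₂
coeffOf-linear f [] β β₁ β₂ h = refl
coeffOf-linear f ((c , γ) ∷ p) β β₁ β₂ h = begin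
  coeffOf (map (map₁ (c *ℤ_)) (f γ) ++ linear f p) β
    ≡⟨ coeffOf-++ (map (map₁ (c *ℤ_)) (f γ)) (linear f p) β ⟩
  coeffOf (map (map₁ (c *ℤ_)) (f γ)) β +ℤ coeffOf (linear f p) β
    ≡⟨ cong₂ _+ℤ_ (trans (coeffOf-scale c (f γ) β) (cong (c *ℤ_) (h γ))) (coeffOf-linear f p β β₁ β₂ h) ⟩
  c *ℤ (m₁ -ℤ m₂) +ℤ (coeffOf p β₁ -ℤ coeffOf p β₂)
    ≡⟨ distribute c m₁ m₂ (coeffOf p β₁) (coeffOf p β₂) ⟩
  (c *ℤ m₁ +ℤ coeffOf p β₁) -ℤ (c *ℤ m₂ +ℤ coeffOf p β₂)
    ≡⟨ cong₂ _-ℤ_ (coeffOf-∷ c γ p β₁) (coeffOf-∷ c γ p β₂) ⟨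
  coeffOf ((c , γ) ∷ p) β₁ -ℤ coeffOf ((c , γ) ∷ p) β₂ ∎
  where
  open ≡-Reasoning
  open +-*-Solver
  m₁ = coeffOf (mono γ) β₁
  m₂ = coeffOf (mono γ) β₂
  distribute : ∀ c m₁ m₂ q₁ q₂ → c *ℤ (m₁ -ℤ m₂) +ℤ (q₁ -ℤ q₂) ≡ (c *ℤ m₁ +ℤ q₁) -ℤ (c *ℤ m₂ +ℤ q₂)
  distribute = solve 5 (λ c m₁ m₂ q₁ q₂ → c :* (m₁ :- m₂) :+ (q₁ :- q₂) := (c :* m₁ :+ q₁) :- (c :* m₂ :+ q₂)) refl

θ̃-coeff-zero : ∀ {n} k (p : Poly n) β → suc k < n → entry (suc (suc k)) β ≡ 0 → coeffOf (θ̃ (suc k) p) β ≡ 0ℤ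
θ̃-coeff-zero k p β k<n β₊≡0 = begin
  coeffOf (θ̃ (suc k) p) β
    ≡⟨ coeffOf-linear (liftAt (suc k) thetaPair) p β β β
         (λ γ → trans (liftAt-thetaPair-coeff-zero k γ β k<n β₊≡0) (sym (ℤ.+-inverseʳ (coeffOf (mono γ) β)))) ⟩
  coeffOf p β -ℤ coeffOf p β
    ≡⟨ ℤ.+-inverseʳ (coeffOf p β) ⟩
  0ℤ ∎
  where open ≡-Reasoning

θ̃-coeff : ∀ {n} k (p : Poly n) β → suc k < n → entry (suc (suc k)) β ≢ 0 →
  coeffOf (θ̃ (suc k) p) β ≡ coeffOf p (gatherLeft (suc k) β) -ℤ coeffOf p (gatherRight (suc k) β)
θ̃-coeff k p β k<n β₊≢0 =
  coeffOf-linear (liftAt (suc k) thetaPair) p β _ _ (λ γ → liftAt-thetaPair-coeff-suc k γ β k<n β₊≢0)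

-- Induction along a reduced word

IsIntervalSum : ∀ {n} → WComp n → Poly n → Set
IsIntervalSum α p = ∀ β → (InInterval α β → coeffOf p β ≡ 1ℤ) × (¬ InInterval α β → coeffOf p β ≡ 0ℤ)

mono-isIntervalSum : ∀ {n} (γ : Vec ℕ n) → inversions γ ≡ 0 → IsIntervalSum γ (mono γ)
mono-isIntervalSum γ γ-flat β = on-interval , off-interval
  where
  γ⊴qγ : γ ⊴ qshift γ
  γ⊴qγ = subst (γ ⊴_) (sym (qshift-flat γ γ-flat)) (⊴-refl γ)
  on-interval : InInterval γ β → coeffOf (mono γ) β ≡ 1ℤ
  on-interval (γ⊴β , β⊴qγ) =
    subst (λ δ → coeffOf (mono γ) δ ≡ 1ℤ) (⊴-antisym γ⊴β (subst (β ⊴_) (qshift-flat γ γ-flat) β⊴qγ)) (coeffOf-hit 1ℤ γ [])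
  off-interval : ¬ InInterval γ β → coeffOf (mono γ) β ≡ 0ℤ
  off-interval β∉ = coeffOf-single-miss 1ℤ γ β (λ γ≡β → β∉ (subst (InInterval γ) γ≡β (⊴-refl γ , γ⊴qγ)))

θ̃-isIntervalSum : ∀ {n j a} {α : Vec ℕ n} (p : Poly n) → Ascent j a α →
  IsIntervalSum (swapAt j α) p → IsIntervalSum α (θ̃ j p)
θ̃-isIntervalSum {j = zero} _ ()
θ̃-isIntervalSum {j = suc k} p asc S β with entry (suc (suc k)) β ≟ 0
... | yes β₊≡0 =
  (λ β∈ → ⊥-elim (entry≡0⇒∉interval asc β β₊≡0 β∈)) ,
  (λ _ → θ̃-coeff-zero k p β (ascent⇒< asc) β₊≡0)
... | no β₊≢0 =
  (λ β∈ → trans split (cong (_-ℤ 0ℤ) (proj₁ (S (gatherLeft (suc k) β)) (gatherLeft-∈interval asc β β∈)))) ,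
  (λ β∉ → trans split (cong (_-ℤ 0ℤ) (proj₂ (S (gatherLeft (suc k) β)) (β∉ ∘′ gatherLeft-∈interval⁻¹ asc β β₊≢0))))
  where
  right≡0 : coeffOf p (gatherRight (suc k) β) ≡ 0ℤ
  right≡0 = proj₂ (S (gatherRight (suc k) β)) (gatherRight-∉interval asc β)
  split : coeffOf (θ̃ (suc k) p) β ≡ coeffOf p (gatherLeft (suc k) β) -ℤ 0ℤ
  split = trans (θ̃-coeff k p β (ascent⇒< asc) β₊≢0) (cong (coeffOf p (gatherLeft (suc k) β) -ℤ_) right≡0)

ReducedWord : ∀ {n} → Vec ℕ n → List ℕ → Set
ReducedWord α u = inversions α ≡ length u + inversions (act u α)

reducedWord-∷ : ∀ {n} j u (α : Vec ℕ n) → ReducedWord α (j ∷ u) →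
  ∃[ a ] Ascent j a (act u α) × ReducedWord α u
reducedWord-∷ j u α reduced = a , asc , (begin-equality
  inversions α                                ≡⟨ reduced ⟩
  suc (length u) + inversions (swapAt j v)    ≡⟨ +-suc (length u) _ ⟨
  length u + suc (inversions (swapAt j v))    ≡⟨ cong (length u +_) (inversions-swapAt-ascent asc) ⟩
  length u + inversions v                     ∎)
  where
  open ≤-Reasoning
  v = act u α
  swap-drops : inversions (swapAt j v) < inversions v
  swap-drops = +-cancelˡ-< (length u) _ _ (begin-strict
    length u + inversions (swapAt j v)        <⟨ ≤-refl ⟩
    suc (length u) + inversions (swapAt j v)  ≡⟨ reduced ⟨
    inversions α                              ≤⟨ inversions≤length+inversions-act u α ⟩
    length u + inversions v                   ∎)
  a = proj₁ (inversions-swapAt-<⇒ascent j v swap-drops)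
  asc = proj₂ (inversions-swapAt-<⇒ascent j v swap-drops)

minFlatWord⇒reducedWord : ∀ {n} (α : Vec ℕ n) u → IsMinFlatWord α u → ReducedWord α u
minFlatWord⇒reducedWord α u (flattens , minimal) = begin-equality
  inversions α                     ≡⟨ ≤-antisym lower upper ⟩
  length u                         ≡⟨ +-identityʳ (length u) ⟨
  length u + 0                     ≡⟨ cong (length u +_) (trans (cong inversions flattens) (inversions-flat α)) ⟨
  length u + inversions (act u α)  ∎
  where
  open ≤-Reasoning
  upper : length u ≤ inversions α
  upper = let w , w-flattens , length-w = flattening-word α in ≤-trans (minimal w w-flattens) (≤-reflexive length-w)
  lower : inversions α ≤ length u
  lower = begin
    inversions α                     ≤⟨ inversions≤length+inversions-act u α ⟩
    length u + inversions (act u α)  ≡⟨ cong (λ v → length u + inversions v) flattens ⟩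
    length u + inversions (flat α)   ≡⟨ cong (length u +_) (inversions-flat α) ⟩
    length u + 0                     ≡⟨ +-identityʳ (length u) ⟩
    length u                         ∎

isIntervalSum-foldl : ∀ {n} u (α : Vec ℕ n) (p : Poly n) → ReducedWord α u →
  IsIntervalSum (act u α) p → IsIntervalSum α (foldl (λ q j → θ̃ j q) p u)
isIntervalSum-foldl [] α p _ S = S
isIntervalSum-foldl (j ∷ u) α p reduced S =
  let a , asc , reduced′ = reducedWord-∷ j u α reduced
  in isIntervalSum-foldl u α (θ̃ j p) reduced′ (θ̃-isIntervalSum p asc S)

atom-isIntervalSum : ∀ {n} (α : Vec ℕ n) u → IsMinFlatWord α u → IsIntervalSum α (atom α u)
atom-isIntervalSum α u minimal =
  isIntervalSum-foldl u α (mono (flat α)) (minFlatWord⇒reducedWord α u minimal)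
    (subst (λ v → IsIntervalSum v (mono (flat α))) (sym (proj₁ minimal)) (mono-isIntervalSum (flat α) (inversions-flat α)))

-- Imported only here: in scope, +_ makes sections such as (m +_) ambiguous.
open import Data.Integer using (+_)

mainTheorem3 : (n : ℕ) (α : WComp n) (u : List ℕ) → IsMinFlatWord α u →
    (β : WComp n) →
      ((α ⊴ β) × (β ⊴ qshift α) → coeff (atom α u) β ≡ + 1)
      × (¬ ((α ⊴ β) × (β ⊴ qshift α)) → coeff (atom α u) β ≡ + 0)
mainTheorem3 n α u minimal β =
  (λ β∈ → trans (coeff≗coeffOf (atom α u) β) (proj₁ (atom-isIntervalSum α u minimal β) β∈)) ,
  (λ β∉ → trans (coeff≗coeffOf (atom α u) β) (proj₂ (atom-isIntervalSum α u minimal β) β∉))
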